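{- Let $n\in\mathbb{N}$ and $S_n=\{(x,k)\in\mathbb{Z}_{\ge 0}^2 : F_n(x,k)>0\}$. Then $$|S_n|=\binom{n+2}{2}-\sum_{i=0}^{n}\left\lfloor \frac{n}{i+1}\right\rfloor .$$
   Context: For integers $n,x,k\ge 0$, $B_n^{x,k}$ denotes the set of binary strings of length $n$ that contain exactly $x$ zeros and in which the longest block of consecutive zeros has length exactly $k$ (so the all-ones string lies in $B_n^{0,0}$). $F_n(x,k)=|B_n^{x,k}|$. -}

module Defs where

open import Data.Bool using (Bool; true; false)
open import Data.Nat using (ℕ; zero; suc; _+_; _⊔_)
open import Data.Nat.Base using (_/_)
open import Data.Nat.Combinatorics using (_C_)
open import Data.Vec using (Vec; []; _∷_)
open import Data.List using (List; []; _∷_; _++_; map; length; upTo)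
open import Data.Nat.ListAction using (sum)
open import Relation.Binary.PropositionalEquality using (_≡_)

-- Binary strings of length n: Vec Bool n, with 'false' = 0 and 'true' = 1.

allStrings : (n : ℕ) → List (Vec Bool n)
allStrings zero = [] ∷ []
allStrings (suc n) = map (false ∷_) (allStrings n) ++ map (true ∷_) (allStrings n)

zeros : ∀ {n} → Vec Bool n → ℕ
zeros [] = 0
zeros (false ∷ v) = suc (zeros v)
zeros (true ∷ v) = zeros v

maxRunFrom : ∀ {n} → ℕ → Vec Bool n → ℕ
maxRunFrom cur [] = cur
maxRunFrom cur (false ∷ v) = maxRunFrom (suc cur) v
maxRunFrom cur (true ∷ v) = cur ⊔ maxRunFrom 0 v

maxZeroRun : ∀ {n} → Vec Bool n → ℕ
maxZeroRun = maxRunFrom 0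

count : ∀ {A : Set} → (A → Bool) → List A → ℕ
count p [] = 0
count p (a ∷ as) with p a
... | true = suc (count p as)
... | false = count p as

open import Data.Nat using (_≡ᵇ_)
open import Data.Bool using (_∧_)

F : ℕ → ℕ → ℕ → ℕ
F n x k = count (λ v → (zeros v ≡ᵇ x) ∧ (maxZeroRun v ≡ᵇ k)) (allStrings n)

floorSum : ℕ → ℕ
floorSum n = sum (map (λ i → n / suc i) (upTo (suc n)))

module Submission where

-- 1. Realisability.  F n x k > 0 iff some string of length n has x zeros and
--    longest zero-block k.  Such a string has n - x ones, hence n - x + 1
--    (possibly empty) zero-blocks, so the pair is *feasible*:
--        x ≤ n,   k ≤ x,   x ≤ k (n - x + 1).
--    Conversely a feasible pair is realised by the greedy string which fills
--    each of the n - x + 1 blocks with min(k, remaining zeros) zeros.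
-- 2. Enumeration.  Grouping feasible pairs by the number i of ones, the row
--    x = n - i consists of the k with ⌈x/(i+1)⌉ ≤ k ≤ x, so it has
--    x + 1 - ⌈x/(i+1)⌉ = (n - i + 1) - ⌊n/(i+1)⌋ elements (because
--    ⌈x/(i+1)⌉ = ⌊(x+i)/(i+1)⌋ = ⌊n/(i+1)⌋).  The rows form a duplicate-free
--    list S n, and summing the row lengths over i = 0..n gives
--        |S n| + Σ_i ⌊n/(i+1)⌋ = Σ_i (n - i + 1) = C(n+2,2).

open import Defs
open import Data.Bool using (Bool; true; false; T; _∧_)
open import Data.Bool.Properties using (T-∧)
open import Data.Empty using (⊥-elim)
open import Data.List using (List; []; _∷_; map; length; concat; applyUpTo)
open import Data.List.Properties using (length-++; length-map; length-applyUpTo; map-applyUpTo; map-upTo)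
open import Data.List.Membership.Propositional using (_∈_; find; lose)
open import Data.List.Membership.Propositional.Properties
  using (∈-++⁺ˡ; ∈-++⁺ʳ; ∈-map⁺; ∈-map⁻; ∈-applyUpTo⁺; ∈-applyUpTo⁻; ∈-concat⁺′; ∈-concat⁻′)
open import Data.List.Relation.Unary.Any using (Any; here; there)
import Data.List.Relation.Unary.All.Properties as All
import Data.List.Relation.Unary.AllPairs.Properties as AllPairs
open import Data.List.Relation.Unary.Unique.Propositional using (Unique)
import Data.List.Relation.Unary.Unique.Propositional.Properties as Unique
open import Data.List.Relation.Binary.Disjoint.Propositional using (Disjoint)
open import Data.Nat
open import Data.Nat.Properties
open import Algebra.Properties.CommutativeSemigroup +-commutativeSemigroup using (interchange; x∙yz≈y∙xz)
open import Data.Nat.DivMod using (m<n*o⇒m/o<n; /-monoˡ-≤; m*n/n≡m)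
open import Data.Nat.Combinatorics using (_C_; nC1≡n; nCk+nC[k+1]≡[n+1]C[k+1])
open import Data.Nat.ListAction using (sum)
open import Data.Product using (Σ; _×_; _,_; proj₂)
open import Data.Vec using (Vec; []; _∷_; replicate) renaming (_++_ to _++ᵥ_)
open import Function using (_∘_)
open import Function.Bundles using (_⇔_; mk⇔; Equivalence)
open import Relation.Binary.PropositionalEquality
open import Relation.Nullary using (yes; no)

count-pos⇒ : ∀ {A : Set} (p : A → Bool) (xs : List A) → 0 < count p xs → Any (T ∘ p) xs
count-pos⇒ p (a ∷ as) pos with p a in pa
... | true  = here (subst T (sym pa) _)
... | false = there (count-pos⇒ p as pos)

count-pos⇐ : ∀ {A : Set} (p : A → Bool) (xs : List A) → Any (T ∘ p) xs → 0 < count p xs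
count-pos⇐ p (a ∷ as) (here pa) with p a
... | true = s≤s z≤n
count-pos⇐ p (a ∷ as) (there rest) with p a
... | true  = s≤s z≤n
... | false = count-pos⇐ p as rest

allStrings-complete : ∀ n (v : Vec Bool n) → v ∈ allStrings n
allStrings-complete zero    []          = here refl
allStrings-complete (suc n) (false ∷ v) = ∈-++⁺ˡ (∈-map⁺ (false ∷_) (allStrings-complete n v))
allStrings-complete (suc n) (true ∷ v)  =
  ∈-++⁺ʳ (map (false ∷_) (allStrings n)) (∈-map⁺ (true ∷_) (allStrings-complete n v))

Realisable : ℕ → ℕ → ℕ → Set
Realisable n x k = Σ (Vec Bool n) λ v → zeros v ≡ x × maxZeroRun v ≡ k

pair-test⇔ : ∀ a b x k → T ((a ≡ᵇ x) ∧ (b ≡ᵇ k)) ⇔ (a ≡ x × b ≡ k)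
pair-test⇔ a b x k = mk⇔
  (λ t → let (tx , tk) = Equivalence.to T-∧ t in ≡ᵇ⇒≡ a x tx , ≡ᵇ⇒≡ b k tk)
  (λ { (a≡x , b≡k) → Equivalence.from T-∧ (≡⇒≡ᵇ a x a≡x , ≡⇒≡ᵇ b k b≡k) })

F-pos⇔realisable : ∀ n x k → 0 < F n x k ⇔ Realisable n x k
F-pos⇔realisable n x k = mk⇔ witness fromWitness
  where
    test : Vec Bool n → Bool
    test v = (zeros v ≡ᵇ x) ∧ (maxZeroRun v ≡ᵇ k)

    witness : 0 < F n x k → Realisable n x k
    witness pos with find (count-pos⇒ test (allStrings n) pos)
    ... | v , _ , t = v , Equivalence.to (pair-test⇔ (zeros v) (maxZeroRun v) x k) t

    fromWitness : Realisable n x k → 0 < F n x k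
    fromWitness (v , eqs) = count-pos⇐ test (allStrings n)
      (lose (allStrings-complete n v) (Equivalence.from (pair-test⇔ (zeros v) (maxZeroRun v) x k) eqs))

-- (x , k) is feasible in length n: at most n zeros, the longest block is not
-- longer than the number of zeros, and the n - x + 1 blocks separated by the
-- n - x ones, each of length ≤ k, hold all x zeros.
Feasible : ℕ → ℕ → ℕ → Set
Feasible n x k = x ≤ n × k ≤ x × x ≤ k * suc (n ∸ x)

zeros≤length : ∀ {n} (v : Vec Bool n) → zeros v ≤ n
zeros≤length []          = z≤n
zeros≤length (false ∷ v) = s≤s (zeros≤length v)
zeros≤length (true ∷ v)  = m≤n⇒m≤1+n (zeros≤length v)

maxRun≤zeros : ∀ {n} c (v : Vec Bool n) → maxRunFrom c v ≤ c + zeros v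
maxRun≤zeros c []          = ≤-reflexive (sym (+-identityʳ c))
maxRun≤zeros c (false ∷ v) = ≤-trans (maxRun≤zeros (suc c) v) (≤-reflexive (sym (+-suc c (zeros v))))
maxRun≤zeros c (true ∷ v)  = ⊔-lub (m≤m+n c (zeros v)) (m≤n⇒m≤o+n c (maxRun≤zeros 0 v))

-- Pigeonhole: the zeros (together with a pending run of c) lie in
-- (number of ones + 1) blocks, none longer than the maximal run.
zeros≤maxRun*blocks : ∀ {n} c (v : Vec Bool n) → c + zeros v ≤ maxRunFrom c v * suc (n ∸ zeros v)
zeros≤maxRun*blocks c [] = ≤-reflexive (trans (+-identityʳ c) (sym (*-identityʳ c)))
zeros≤maxRun*blocks c (false ∷ v) =
  ≤-trans (≤-reflexive (+-suc c (zeros v))) (zeros≤maxRun*blocks (suc c) v)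
zeros≤maxRun*blocks {suc n} c (true ∷ v) = begin
    c + zeros v
  ≤⟨ +-mono-≤ (m≤m⊔n c r) (≤-trans (zeros≤maxRun*blocks 0 v) (*-monoˡ-≤ (suc b) (m≤n⊔m c r))) ⟩
    (c ⊔ r) + (c ⊔ r) * suc b
  ≡⟨ sym (*-suc (c ⊔ r) (suc b)) ⟩
    (c ⊔ r) * suc (suc b)
  ≡⟨ cong (λ t → (c ⊔ r) * suc t) (sym (+-∸-assoc 1 (zeros≤length v))) ⟩
    (c ⊔ r) * suc (suc n ∸ zeros v) ∎
  where
    open ≤-Reasoning
    r b : ℕ
    r = maxRunFrom 0 v
    b = n ∸ zeros v

realisable⇒feasible : ∀ n x k → Realisable n x k → Feasible n x k
realisable⇒feasible n _ _ (v , refl , refl) = zeros≤length v , maxRun≤zeros 0 v , zeros≤maxRun*blocks 0 v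

zeros-prefix : ∀ j {m} (w : Vec Bool m) → zeros (replicate j false ++ᵥ w) ≡ j + zeros w
zeros-prefix zero    w = refl
zeros-prefix (suc j) w = cong suc (zeros-prefix j w)

maxRun-prefix : ∀ j c {m} (w : Vec Bool m) → maxRunFrom c (replicate j false ++ᵥ w) ≡ maxRunFrom (j + c) w
maxRun-prefix zero    c w = refl
maxRun-prefix (suc j) c w = trans (maxRun-prefix j (suc c) w) (cong (λ t → maxRunFrom t w) (+-suc j c))

-- Its length is kept
-- as a separate field, known only up to the equation len ≡ o + z, so that
-- strings can be glued together without transporting along length equations.
record Arrangement (o z r : ℕ) : Set where
  field
    len     : ℕ
    string  : Vec Bool len
    length≡ : len ≡ o + z
    zeros≡  : zeros string ≡ z
    maxRun≡ : maxZeroRun string ≡ r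

reindex : ∀ {o z z′ r r′} → z ≡ z′ → r ≡ r′ → Arrangement o z r → Arrangement o z′ r′
reindex refl refl a = a

-- The string of z zeros (written with an empty tail to reuse the prefix lemmas).
zeroBlock : ∀ z → Arrangement 0 z z
zeroBlock z = record
  { len     = z + 0
  ; string  = replicate z false ++ᵥ []
  ; length≡ = +-identityʳ z
  ; zeros≡  = trans (zeros-prefix z []) (+-identityʳ z)
  ; maxRun≡ = trans (maxRun-prefix z 0 []) (+-identityʳ z)
  }

consBlock : ∀ j {o z r} → Arrangement o z r → Arrangement (suc o) (j + z) (j ⊔ r)
consBlock j {o} {z} a = record
  { len     = j + suc len
  ; string  = replicate j false ++ᵥ (true ∷ string)
  ; length≡ = begin
      j + suc len       ≡⟨ cong (λ l → j + suc l) length≡ ⟩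
      j + suc (o + z)   ≡⟨ +-suc j (o + z) ⟩
      suc (j + (o + z)) ≡⟨ cong suc (x∙yz≈y∙xz j o z) ⟩
      suc (o + (j + z)) ∎
  ; zeros≡  = trans (zeros-prefix j (true ∷ string)) (cong (j +_) zeros≡)
  ; maxRun≡ = trans (maxRun-prefix j 0 (true ∷ string)) (cong₂ _⊔_ (+-identityʳ j) maxRun≡)
  }
  where
    open Arrangement a
    open ≡-Reasoning

-- Greedy filling: with o ones and z ≤ k (o + 1) zeros, put min(z , k) zeros
-- before the first one and recurse; the first block is then a longest one.
greedy : ∀ k o z → z ≤ k * suc o → Arrangement o z (z ⊓ k)
greedy k zero z z≤k*1 =
  reindex refl (sym (m≤n⇒m⊓n≡m (≤-trans z≤k*1 (≤-reflexive (*-identityʳ k))))) (zeroBlock z)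
greedy k (suc o) z bound with z ≤? k
... | yes z≤k = reindex (+-identityʳ z) (trans (⊔-identityʳ z) (sym (m≤n⇒m⊓n≡m z≤k)))
                        (consBlock z (greedy k o 0 z≤n))
... | no z≰k  = reindex (m+[n∸m]≡n k≤z) (trans (m≥n⇒m⊔n≡m (m⊓n≤n (z ∸ k) k)) (sym (m≥n⇒m⊓n≡n k≤z)))
                        (consBlock k (greedy k o (z ∸ k) rest))
  where
    k≤z : k ≤ z
    k≤z = <⇒≤ (≰⇒> z≰k)
    rest : z ∸ k ≤ k * suc o
    rest = ≤-trans (∸-monoˡ-≤ k bound) (≤-reflexive (trans (cong (_∸ k) (*-suc k (suc o))) (m+n∸m≡n k (k * suc o))))

arrangement⇒realisable : ∀ {o z r n} → Arrangement o z r → o + z ≡ n → Realisable n z r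
arrangement⇒realisable record { string = v ; length≡ = refl ; zeros≡ = zs ; maxRun≡ = mr } refl = v , zs , mr

feasible⇒realisable : ∀ n x k → Feasible n x k → Realisable n x k
feasible⇒realisable n x k (x≤n , k≤x , bound) =
  arrangement⇒realisable (reindex refl (m≥n⇒m⊓n≡n k≤x) (greedy k (n ∸ x) x bound)) (m∸n+n≡m x≤n)

-- ⌈ x / (i + 1) ⌉, expressed with floor division.
ceilDiv : ℕ → ℕ → ℕ
ceilDiv x i = (x + i) / suc i

ceilDiv-≤⇔ : ∀ x i k → ceilDiv x i ≤ k ⇔ x ≤ k * suc i
ceilDiv-≤⇔ x i k = mk⇔ to from
  where
    from : x ≤ k * suc i → ceilDiv x i ≤ k
    from x≤km = s≤s⁻¹ (m<n*o⇒m/o<n (begin-strict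
      x + i         ≤⟨ +-monoˡ-≤ i x≤km ⟩
      k * suc i + i ≡⟨ +-comm (k * suc i) i ⟩
      i + k * suc i <⟨ n<1+n (i + k * suc i) ⟩
      suc k * suc i ∎))
      where open ≤-Reasoning

    to : ceilDiv x i ≤ k → x ≤ k * suc i
    to q≤k with x ≤? k * suc i
    ... | yes x≤km = x≤km
    ... | no  x≰km = ⊥-elim (<⇒≱ (s≤s q≤k) (begin
      suc k                       ≡⟨ sym (m*n/n≡m (suc k) (suc i)) ⟩
      suc k * suc i / suc i       ≤⟨ /-monoˡ-≤ (suc i) (begin
          suc (i + k * suc i)     ≡⟨ cong suc (+-comm i (k * suc i)) ⟩
          suc (k * suc i) + i     ≤⟨ +-monoˡ-≤ i (≰⇒> x≰km) ⟩
          x + i                   ∎) ⟩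
      ceilDiv x i                 ∎))
      where open ≤-Reasoning

ceilDiv≤ : ∀ x i → ceilDiv x i ≤ x
ceilDiv≤ x i = Equivalence.from (ceilDiv-≤⇔ x i x) (m≤m*n x (suc i))

-- The interval lo, lo + 1, …, hi of naturals (empty when hi < lo).
interval : ℕ → ℕ → List ℕ
interval lo hi = applyUpTo (lo +_) (suc hi ∸ lo)

∈-interval⁺ : ∀ {lo hi k} → lo ≤ k → k ≤ hi → k ∈ interval lo hi
∈-interval⁺ {lo} {hi} {k} lo≤k k≤hi =
  subst (_∈ interval lo hi) (m+[n∸m]≡n lo≤k) (∈-applyUpTo⁺ (lo +_) (∸-monoˡ-< (s≤s k≤hi) lo≤k))

∈-interval⁻ : ∀ {lo hi k} → k ∈ interval lo hi → lo ≤ k × k ≤ hi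
∈-interval⁻ {lo} {hi} k∈ with ∈-applyUpTo⁻ (lo +_) k∈
... | j , j<len , refl = m≤m+n lo j , inRange
  where
    inRange : lo + j ≤ hi
    inRange with lo + j ≤? hi
    ... | yes lo+j≤hi = lo+j≤hi
    ... | no  lo+j≰hi = ⊥-elim (<⇒≱ j<len (m≤n+o⇒m∸n≤o (suc hi) lo (≰⇒> lo+j≰hi)))

interval-unique : ∀ lo hi → Unique (interval lo hi)
interval-unique lo hi = Unique.applyUpTo⁺₁ (lo +_) (suc hi ∸ lo) (λ i<j _ → <⇒≢ i<j ∘ +-cancelˡ-≡ lo _ _)

-- Row i of S n: the feasible pairs with x zeros and i ones, namely
-- (x , k) for ⌈x/(i+1)⌉ ≤ k ≤ x.
row : ℕ → ℕ → List (ℕ × ℕ)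
row x i = map (x ,_) (interval (ceilDiv x i) x)

∈-row⁺ : ∀ {x i k} → x ≤ k * suc i → k ≤ x → (x , k) ∈ row x i
∈-row⁺ {x} {i} x≤ki k≤x = ∈-map⁺ (x ,_) (∈-interval⁺ (Equivalence.from (ceilDiv-≤⇔ x i _) x≤ki) k≤x)

∈-row⁻ : ∀ {x i a k} → (a , k) ∈ row x i → a ≡ x × x ≤ k * suc i × k ≤ x
∈-row⁻ {x} {i} a,k∈ with ∈-map⁻ (x ,_) a,k∈
... | k , k∈ , refl with ∈-interval⁻ k∈
... | q≤k , k≤x = refl , Equivalence.to (ceilDiv-≤⇔ x i k) q≤k , k≤x

row-unique : ∀ x i → Unique (row x i)
row-unique x i = Unique.map⁺ (cong proj₂) (interval-unique (ceilDiv x i) x)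

length-row : ∀ x i → length (row x i) ≡ suc x ∸ ceilDiv x i
length-row x i = trans (length-map (x ,_) (interval (ceilDiv x i) x)) (length-applyUpTo _ _)

Sn : ℕ → List (ℕ × ℕ)
Sn n = concat (applyUpTo (λ i → row (n ∸ i) i) (suc n))

-- S n lists exactly the feasible pairs; the row of (x , k) is i = n - x.
∈-Sn⇔feasible : ∀ n x k → (x , k) ∈ Sn n ⇔ Feasible n x k
∈-Sn⇔feasible n x k = mk⇔ to from
  where
    to : (x , k) ∈ Sn n → Feasible n x k
    to x,k∈ with ∈-concat⁻′ (applyUpTo (λ i → row (n ∸ i) i) (suc n)) x,k∈
    ... | _ , x,k∈row , row∈ with ∈-applyUpTo⁻ (λ i → row (n ∸ i) i) row∈
    ... | i , i<1+n , refl with ∈-row⁻ x,k∈row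
    ... | refl , x≤ki , k≤x =
      m∸n≤m n i , k≤x , subst (λ t → x ≤ k * suc t) (sym (m∸[m∸n]≡n (s≤s⁻¹ i<1+n))) x≤ki

    from : Feasible n x k → (x , k) ∈ Sn n
    from (x≤n , k≤x , x≤ki) = ∈-concat⁺′ inRow (∈-applyUpTo⁺ (λ i → row (n ∸ i) i) (s≤s (m∸n≤m n x)))
      where
        inRow : (x , k) ∈ row (n ∸ (n ∸ x)) (n ∸ x)
        inRow = subst (λ t → (x , k) ∈ row t (n ∸ x)) (sym (m∸[m∸n]≡n x≤n)) (∈-row⁺ x≤ki k≤x)

-- Distinct rows have distinct numbers of zeros, so S n has no duplicates.
Sn-unique : ∀ n → Unique (Sn n)
Sn-unique n = Unique.concat⁺
  (All.applyUpTo⁺₂ (λ i → row (n ∸ i) i) (suc n) (λ i → row-unique (n ∸ i) i))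
  (AllPairs.applyUpTo⁺₁ (λ i → row (n ∸ i) i) (suc n) disjoint)
  where
    disjoint : ∀ {i j} → i < j → j < suc n → Disjoint (row (n ∸ i) i) (row (n ∸ j) j)
    disjoint i<j j<1+n (∈i , ∈j) with ∈-row⁻ ∈i | ∈-row⁻ ∈j
    ... | refl , _ | n∸i≡n∸j , _ =
      <⇒≢ i<j (∸-cancelˡ-≡ (≤-trans (<⇒≤ i<j) (s≤s⁻¹ j<1+n)) (s≤s⁻¹ j<1+n) n∸i≡n∸j)

length-concat : ∀ {A : Set} (xss : List (List A)) → length (concat xss) ≡ sum (map length xss)
length-concat []         = refl
length-concat (xs ∷ xss) = trans (length-++ xs) (cong (length xs +_) (length-concat xss))

sum-applyUpTo-+ : ∀ (f g h : ℕ → ℕ) N → (∀ i → i < N → f i + g i ≡ h i) →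
                  sum (applyUpTo f N) + sum (applyUpTo g N) ≡ sum (applyUpTo h N)
sum-applyUpTo-+ f g h zero    _  = refl
sum-applyUpTo-+ f g h (suc N) eq =
  trans (interchange (f 0) (sum (applyUpTo (f ∘ suc) N)) (g 0) (sum (applyUpTo (g ∘ suc) N)))
        (cong₂ _+_ (eq 0 z<s) (sum-applyUpTo-+ (f ∘ suc) (g ∘ suc) (h ∘ suc) N (λ i i<N → eq (suc i) (s<s i<N))))

sum-descending : ∀ n → sum (applyUpTo (λ i → suc (n ∸ i)) (suc n)) ≡ suc (suc n) C 2
sum-descending zero    = refl
sum-descending (suc n) = begin
  suc (suc n) + sum (applyUpTo (λ i → suc (n ∸ i)) (suc n)) ≡⟨ cong₂ _+_ (sym (nC1≡n (suc (suc n)))) (sum-descending n) ⟩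
  suc (suc n) C 1 + suc (suc n) C 2                          ≡⟨ nCk+nC[k+1]≡[n+1]C[k+1] (suc (suc n)) 1 ⟩
  suc (suc (suc n)) C 2                                      ∎
  where open ≡-Reasoning

-- Row i has (n - i + 1) - ⌊n/(i+1)⌋ elements, since ⌈(n-i)/(i+1)⌉ = ⌊n/(i+1)⌋.
length-row+floor : ∀ n i → i ≤ n → length (row (n ∸ i) i) + n / suc i ≡ suc (n ∸ i)
length-row+floor n i i≤n = begin
  length (row (n ∸ i) i) + n / suc i                 ≡⟨ cong₂ _+_ (length-row (n ∸ i) i) (cong (_/ suc i) (sym (m∸n+n≡m i≤n))) ⟩
  suc (n ∸ i) ∸ ceilDiv (n ∸ i) i + ceilDiv (n ∸ i) i ≡⟨ m∸n+n≡m (m≤n⇒m≤1+n (ceilDiv≤ (n ∸ i) i)) ⟩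
  suc (n ∸ i)                                         ∎
  where open ≡-Reasoning

Sn-length : ∀ n → length (Sn n) + floorSum n ≡ (n + 2) C 2
Sn-length n = begin
  length (Sn n) + floorSum n
    ≡⟨ cong₂ _+_ (trans (length-concat (applyUpTo rowOf (suc n))) (cong sum (map-applyUpTo rowOf length (suc n))))
                 (cong sum (map-upTo floorOf (suc n))) ⟩
  sum (applyUpTo (length ∘ rowOf) (suc n)) + sum (applyUpTo floorOf (suc n))
    ≡⟨ sum-applyUpTo-+ (length ∘ rowOf) floorOf (λ i → suc (n ∸ i)) (suc n)
                       (λ i i<1+n → length-row+floor n i (s≤s⁻¹ i<1+n)) ⟩
  sum (applyUpTo (λ i → suc (n ∸ i)) (suc n))
    ≡⟨ sum-descending n ⟩
  suc (suc n) C 2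
    ≡⟨ cong (_C 2) (+-comm 2 n) ⟩
  (n + 2) C 2 ∎
  where
    open ≡-Reasoning
    rowOf : ℕ → List (ℕ × ℕ)
    rowOf i = row (n ∸ i) i
    floorOf : ℕ → ℕ
    floorOf i = n / suc i

theorem2p3 : (n : ℕ) →
    Σ (List (ℕ × ℕ)) λ Sn →
      Unique Sn
      × ((x k : ℕ) → (((x , k) ∈ Sn) ⇔ (0 < F n x k)))
      × (length Sn + floorSum n ≡ (n + 2) C 2)
theorem2p3 n = Sn n , Sn-unique n , characterisation , Sn-length n
  where
    characterisation : (x k : ℕ) → ((x , k) ∈ Sn n) ⇔ (0 < F n x k)
    characterisation x k = mk⇔
      (Equivalence.from (F-pos⇔realisable n x k) ∘ feasible⇒realisable n x k ∘ Equivalence.to (∈-Sn⇔feasible n x k))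
      (Equivalence.from (∈-Sn⇔feasible n x k) ∘ realisable⇒feasible n x k ∘ Equivalence.to (F-pos⇔realisable n x k))
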